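{- Let $i\in\{\mathsf{K},\mathsf{T},\mathsf{K4},\mathsf{S4},\mathsf{S5}\}$. For every sequent $\Gamma\Rightarrow A$ in the language of $\mathsf{BFNL^*}$ (containing no $\Diamond$, $\Box^\downarrow$ and no unary structure $\langle-\rangle$), $\vdash_{\mathsf{BFNL^*}}\Gamma\Rightarrow A$ if and only if $\vdash_{\mathsf{BFNL^*_i}}\Gamma\Rightarrow A$.
   Context: $\mathsf{BFNL^*}$: formulas $A::=p\mid\top\mid\bot\mid\neg A\mid A\wedge B\mid A\vee B\mid A\cdot B\mid A\backslash B\mid A/B$; formula trees $\Gamma::=A\mid\Gamma\circ\Delta$ ($\Gamma[\Delta]$: distinguished subtree occurrence); sequents $\Gamma\Rightarrow A$ with $\Gamma$ a tree or empty. Axioms: $A\Rightarrow A$; $A\wedge(B\vee C)\Rightarrow(A\wedge B)\vee(A\wedge C)$; $\Gamma[\bot]\Rightarrow A$; $\Gamma\Rightarrow\top$; $A\wedge\neg A\Rightarrow\bot$; $\top\Rightarrow A\vee\neg A$. Rules: from $\Delta\Rightarrow A$, $\Gamma[B]\Rightarrow C$ infer $\Gamma[\Delta\circ(A\backslash B)]\Rightarrow C$; from $A\circ\Gamma\Rightarrow B$ infer $\Gamma\Rightarrow A\backslash B$; from $\Gamma[A]\Rightarrow C$, $\Delta\Rightarrow B$ infer $\Gamma[(A/B)\circ\Delta]\Rightarrow C$; from $\Gamma\circ B\Rightarrow A$ infer $\Gamma\Rightarrow A/B$ ($\Gamma$ may be empty in these two); from $\Gamma[A\circ B]\Rightarrow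 C$ infer $\Gamma[A\cdot B]\Rightarrow C$; from $\Gamma\Rightarrow A$, $\Delta\Rightarrow B$ infer $\Gamma\circ\Delta\Rightarrow A\cdot B$; Cut: from $\Delta\Rightarrow A$, $\Gamma[A]\Rightarrow B$ infer $\Gamma[\Delta]\Rightarrow B$; from $\Gamma[A_i]\Rightarrow B$ infer $\Gamma[A_1\wedge A_2]\Rightarrow B$; from $\Gamma\Rightarrow A$, $\Gamma\Rightarrow B$ infer $\Gamma\Rightarrow A\wedge B$; from $\Gamma[A_1]\Rightarrow B$, $\Gamma[A_2]\Rightarrow B$ infer $\Gamma[A_1\vee A_2]\Rightarrow B$; from $\Gamma\Rightarrow A_i$ infer $\Gamma\Rightarrow A_1\vee A_2$. The modal systems $\mathsf{BFNL^*_i}$: formulas additionally include $\Diamond A$ and $\Box^\downarrow A$; formula trees additionally include $\langle\Gamma\rangle$; all rules above apply to this extended language, plus: from $\Gamma[\langle A\rangle]\Rightarrow B$ infer $\Gamma[\Diamond A]\Rightarrow B$; from $\Gamma\Rightarrow A$ infer $\langle\Gamma\rangle\Rightarrow\Diamond A$; from $\Gamma[A]\Rightarrow B$ infer $\Gamma[\langle\Box^\downarrow A\rangle]\Rightarrow B$; from $\langle\Gamma\rangle\Rightarrow A$ infer $\Gamma\Rightarrow\Box^\downarrow A$. With $\Box A:=\neg\Diamond\neg A$, the axiom schemes (T) $A\Rightarrow\Diamond A$, (4) $\Diamond\Diamond A\Rightarrow\Diamond A$, (5) $\Diamond A\Rightarrow\Box\Diamond A$ are added as follows: $\mathsf{BFNL^*_K}$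 none, $\mathsf{BFNL^*_T}$ (T), $\mathsf{BFNL^*_{K4}}$ (4), $\mathsf{BFNL^*_{S4}}$ (T),(4), $\mathsf{BFNL^*_{S5}}$ (T),(4),(5). -}

module Defs where

open import Data.Nat using (ℕ)

Atom : Set
Atom = ℕ

infixr 30 _·_
infix 40 ¬_
infix 25 _∧_ _∨_

data Fm : Set where
  var  : Atom → Fm
  ⊤ ⊥  : Fm
  ¬_   : Fm → Fm
  _∧_ _∨_ _·_ _＼_ _／_ : Fm → Fm → Fm

data Tree : Set where
  leaf : Fm → Tree
  _∘_  : Tree → Tree → Tree

data Ctx : Set where
  []   : Ctx
  _∘ˡ_ : Ctx → Tree → Ctx
  _∘ʳ_ : Tree → Ctx → Ctx

_[_] : Ctx → Tree → Tree
[] [ Δ ] = Δ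
(Γ ∘ˡ Θ) [ Δ ] = (Γ [ Δ ]) ∘ Θ
(Θ ∘ʳ Γ) [ Δ ] = Θ ∘ (Γ [ Δ ])

data Ante : Set where
  ε : Ante
  ⌊_⌋ : Tree → Ante

_◁_ : Fm → Ante → Tree
A ◁ ε = leaf A
A ◁ ⌊ Γ ⌋ = leaf A ∘ Γ

_▷_ : Ante → Fm → Tree
ε ▷ B = leaf B
⌊ Γ ⌋ ▷ B = Γ ∘ leaf B

infix 10 _⊢_
data _⊢_ : Ante → Fm → Set where
  id   : ∀ {A} → ⌊ leaf A ⌋ ⊢ A
  dist : ∀ {A B C} → ⌊ leaf (A ∧ (B ∨ C)) ⌋ ⊢ (A ∧ B) ∨ (A ∧ C)
  ⊥L   : ∀ Γ {A} → ⌊ Γ [ leaf ⊥ ] ⌋ ⊢ A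
  ⊤R   : ∀ {Γ} → Γ ⊢ ⊤
  negL : ∀ {A} → ⌊ leaf (A ∧ ¬ A) ⌋ ⊢ ⊥
  negR : ∀ {A} → ⌊ leaf ⊤ ⌋ ⊢ A ∨ ¬ A
  ＼L  : ∀ Γ {Δ A B C} → ⌊ Δ ⌋ ⊢ A → ⌊ Γ [ leaf B ] ⌋ ⊢ C
       → ⌊ Γ [ Δ ∘ leaf (A ＼ B) ] ⌋ ⊢ C
  ＼R  : ∀ {Γ A B} → ⌊ A ◁ Γ ⌋ ⊢ B → Γ ⊢ A ＼ B
  ／L  : ∀ Γ {Δ A B C} → ⌊ Γ [ leaf A ] ⌋ ⊢ C → ⌊ Δ ⌋ ⊢ B
       → ⌊ Γ [ leaf (A ／ B) ∘ Δ ] ⌋ ⊢ C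
  ／R  : ∀ {Γ A B} → ⌊ Γ ▷ B ⌋ ⊢ A → Γ ⊢ A ／ B
  ·L   : ∀ Γ {A B C} → ⌊ Γ [ leaf A ∘ leaf B ] ⌋ ⊢ C → ⌊ Γ [ leaf (A · B) ] ⌋ ⊢ C
  ·R   : ∀ {Γ Δ A B} → ⌊ Γ ⌋ ⊢ A → ⌊ Δ ⌋ ⊢ B → ⌊ Γ ∘ Δ ⌋ ⊢ A · B
  cut  : ∀ Γ {Δ A B} → ⌊ Δ ⌋ ⊢ A → ⌊ Γ [ leaf A ] ⌋ ⊢ B → ⌊ Γ [ Δ ] ⌋ ⊢ B
  ∧L₁  : ∀ Γ {A₁ A₂ B} → ⌊ Γ [ leaf A₁ ] ⌋ ⊢ B → ⌊ Γ [ leaf (A₁ ∧ A₂) ] ⌋ ⊢ B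
  ∧L₂  : ∀ Γ {A₁ A₂ B} → ⌊ Γ [ leaf A₂ ] ⌋ ⊢ B → ⌊ Γ [ leaf (A₁ ∧ A₂) ] ⌋ ⊢ B
  ∧R   : ∀ {Γ A B} → Γ ⊢ A → Γ ⊢ B → Γ ⊢ A ∧ B
  ∨L   : ∀ Γ {A₁ A₂ B} → ⌊ Γ [ leaf A₁ ] ⌋ ⊢ B → ⌊ Γ [ leaf A₂ ] ⌋ ⊢ B
       → ⌊ Γ [ leaf (A₁ ∨ A₂) ] ⌋ ⊢ B
  ∨R₁  : ∀ {Γ A₁ A₂} → Γ ⊢ A₁ → Γ ⊢ A₁ ∨ A₂
  ∨R₂  : ∀ {Γ A₁ A₂} → Γ ⊢ A₂ → Γ ⊢ A₁ ∨ A₂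

data Sys : Set where
  K T K4 S4 S5 : Sys

data HasT : Sys → Set where
  T-T : HasT T
  T-S4 : HasT S4
  T-S5 : HasT S5

data Has4 : Sys → Set where
  4-K4 : Has4 K4
  4-S4 : Has4 S4
  4-S5 : Has4 S5

data Has5 : Sys → Set where
  5-S5 : Has5 S5

data MFm : Set where
  var  : Atom → MFm
  ⊤ ⊥  : MFm
  ¬_   : MFm → MFm
  _∧_ _∨_ _·_ _＼_ _／_ : MFm → MFm → MFm
  ◇ □↓ : MFm → MFm

□ : MFm → MFm
□ A = ¬ ◇ (¬ A)

data MTree : Set where
  leaf : MFm → MTree
  _∘_  : MTree → MTree → MTree
  ⟨_⟩  : MTree → MTree

data MCtx : Set where
  []   : MCtx
  _∘ˡ_ : MCtx → MTree → MCtx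
  _∘ʳ_ : MTree → MCtx → MCtx
  ⟨_⟩  : MCtx → MCtx

_[_]ₘ : MCtx → MTree → MTree
[] [ Δ ]ₘ = Δ
(Γ ∘ˡ Θ) [ Δ ]ₘ = (Γ [ Δ ]ₘ) ∘ Θ
(Θ ∘ʳ Γ) [ Δ ]ₘ = Θ ∘ (Γ [ Δ ]ₘ)
⟨ Γ ⟩ [ Δ ]ₘ = ⟨ Γ [ Δ ]ₘ ⟩

data MAnte : Set where
  ε : MAnte
  ⌊_⌋ : MTree → MAnte

_◁ₘ_ : MFm → MAnte → MTree
A ◁ₘ ε = leaf A
A ◁ₘ ⌊ Γ ⌋ = leaf A ∘ Γ

_▷ₘ_ : MAnte → MFm → MTree
ε ▷ₘ B = leaf B
⌊ Γ ⌋ ▷ₘ B = Γ ∘ leaf B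

infix 10 _⊢[_]_
data _⊢[_]_ : MAnte → Sys → MFm → Set where
  id   : ∀ {i A} → ⌊ leaf A ⌋ ⊢[ i ] A
  dist : ∀ {i A B C} → ⌊ leaf (A ∧ (B ∨ C)) ⌋ ⊢[ i ] (A ∧ B) ∨ (A ∧ C)
  ⊥L   : ∀ {i} Γ {A} → ⌊ Γ [ leaf ⊥ ]ₘ ⌋ ⊢[ i ] A
  ⊤R   : ∀ {i Γ} → Γ ⊢[ i ] ⊤
  negL : ∀ {i A} → ⌊ leaf (A ∧ ¬ A) ⌋ ⊢[ i ] ⊥
  negR : ∀ {i A} → ⌊ leaf ⊤ ⌋ ⊢[ i ] A ∨ ¬ A
  ＼L  : ∀ {i} Γ {Δ A B C} → ⌊ Δ ⌋ ⊢[ i ] A → ⌊ Γ [ leaf B ]ₘ ⌋ ⊢[ i ] C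
       → ⌊ Γ [ Δ ∘ leaf (A ＼ B) ]ₘ ⌋ ⊢[ i ] C
  ＼R  : ∀ {i Γ A B} → ⌊ A ◁ₘ Γ ⌋ ⊢[ i ] B → Γ ⊢[ i ] A ＼ B
  ／L  : ∀ {i} Γ {Δ A B C} → ⌊ Γ [ leaf A ]ₘ ⌋ ⊢[ i ] C → ⌊ Δ ⌋ ⊢[ i ] B
       → ⌊ Γ [ leaf (A ／ B) ∘ Δ ]ₘ ⌋ ⊢[ i ] C
  ／R  : ∀ {i Γ A B} → ⌊ Γ ▷ₘ B ⌋ ⊢[ i ] A → Γ ⊢[ i ] A ／ B
  ·L   : ∀ {i} Γ {A B C} → ⌊ Γ [ leaf A ∘ leaf B ]ₘ ⌋ ⊢[ i ] C
       → ⌊ Γ [ leaf (A · B) ]ₘ ⌋ ⊢[ i ] C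
  ·R   : ∀ {i Γ Δ A B} → ⌊ Γ ⌋ ⊢[ i ] A → ⌊ Δ ⌋ ⊢[ i ] B → ⌊ Γ ∘ Δ ⌋ ⊢[ i ] A · B
  cut  : ∀ {i} Γ {Δ A B} → ⌊ Δ ⌋ ⊢[ i ] A → ⌊ Γ [ leaf A ]ₘ ⌋ ⊢[ i ] B
       → ⌊ Γ [ Δ ]ₘ ⌋ ⊢[ i ] B
  ∧L₁  : ∀ {i} Γ {A₁ A₂ B} → ⌊ Γ [ leaf A₁ ]ₘ ⌋ ⊢[ i ] B
       → ⌊ Γ [ leaf (A₁ ∧ A₂) ]ₘ ⌋ ⊢[ i ] B
  ∧L₂  : ∀ {i} Γ {A₁ A₂ B} → ⌊ Γ [ leaf A₂ ]ₘ ⌋ ⊢[ i ] B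
       → ⌊ Γ [ leaf (A₁ ∧ A₂) ]ₘ ⌋ ⊢[ i ] B
  ∧R   : ∀ {i Γ A B} → Γ ⊢[ i ] A → Γ ⊢[ i ] B → Γ ⊢[ i ] A ∧ B
  ∨L   : ∀ {i} Γ {A₁ A₂ B} → ⌊ Γ [ leaf A₁ ]ₘ ⌋ ⊢[ i ] B → ⌊ Γ [ leaf A₂ ]ₘ ⌋ ⊢[ i ] B
       → ⌊ Γ [ leaf (A₁ ∨ A₂) ]ₘ ⌋ ⊢[ i ] B
  ∨R₁  : ∀ {i Γ A₁ A₂} → Γ ⊢[ i ] A₁ → Γ ⊢[ i ] A₁ ∨ A₂
  ∨R₂  : ∀ {i Γ A₁ A₂} → Γ ⊢[ i ] A₂ → Γ ⊢[ i ] A₁ ∨ A₂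
  ◇L   : ∀ {i} Γ {A B} → ⌊ Γ [ ⟨ leaf A ⟩ ]ₘ ⌋ ⊢[ i ] B → ⌊ Γ [ leaf (◇ A) ]ₘ ⌋ ⊢[ i ] B
  ◇R   : ∀ {i Γ A} → ⌊ Γ ⌋ ⊢[ i ] A → ⌊ ⟨ Γ ⟩ ⌋ ⊢[ i ] ◇ A
  □↓L  : ∀ {i} Γ {A B} → ⌊ Γ [ leaf A ]ₘ ⌋ ⊢[ i ] B → ⌊ Γ [ ⟨ leaf (□↓ A) ⟩ ]ₘ ⌋ ⊢[ i ] B
  □↓R  : ∀ {i Γ A} → ⌊ ⟨ Γ ⟩ ⌋ ⊢[ i ] A → ⌊ Γ ⌋ ⊢[ i ] □↓ A
  axT  : ∀ {i A} → HasT i → ⌊ leaf A ⌋ ⊢[ i ] ◇ A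
  ax4  : ∀ {i A} → Has4 i → ⌊ leaf (◇ (◇ A)) ⌋ ⊢[ i ] ◇ A
  ax5  : ∀ {i A} → Has5 i → ⌊ leaf (◇ A) ⌋ ⊢[ i ] □ (◇ A)

emb : Fm → MFm
emb (var p) = var p
emb ⊤ = ⊤
emb ⊥ = ⊥
emb (¬ A) = ¬ emb A
emb (A ∧ B) = emb A ∧ emb B
emb (A ∨ B) = emb A ∨ emb B
emb (A · B) = emb A · emb B
emb (A ＼ B) = emb A ＼ emb B
emb (A ／ B) = emb A ／ emb B

embT : Tree → MTree
embT (leaf A) = leaf (emb A)
embT (Γ ∘ Δ) = embT Γ ∘ embT Δ

embA : Ante → MAnte
embA ε = ε
embA ⌊ Γ ⌋ = ⌊ embT Γ ⌋

-- Embedding BFNL* into BFNL*_i preserves derivability, since every rule of BFNL* is also a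
-- rule of BFNL*_i. Conversely, erasing ◇, □↓ and the brackets ⟨-⟩ sends every modal rule to
-- a trivial step and the axioms (T) and (4) to instances of A ⇒ A; the erasure of (5) is
-- A ⇒ ¬¬A, which holds in BFNL* because negation is Boolean. Erasure is a left inverse of the
-- embedding, so a modal derivation of an embedded sequent erases to a derivation in BFNL*.
module Submission where

open import Defs
open import Function.Bundles using (_⇔_; mk⇔)
open import Relation.Binary.PropositionalEquality using (_≡_; refl; sym; cong; cong₂; subst; subst₂)

embC : Ctx → MCtx
embC [] = []
embC (Γ ∘ˡ Θ) = embC Γ ∘ˡ embT Θ
embC (Θ ∘ʳ Γ) = embT Θ ∘ʳ embC Γ

embT-plug : ∀ Γ Δ → embT (Γ [ Δ ]) ≡ embC Γ [ embT Δ ]ₘ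
embT-plug [] Δ = refl
embT-plug (Γ ∘ˡ Θ) Δ = cong (_∘ embT Θ) (embT-plug Γ Δ)
embT-plug (Θ ∘ʳ Γ) Δ = cong (embT Θ ∘_) (embT-plug Γ Δ)

emb-plugged : ∀ {i} Γ {Δ B} → ⌊ embC Γ [ embT Δ ]ₘ ⌋ ⊢[ i ] B → ⌊ embT (Γ [ Δ ]) ⌋ ⊢[ i ] B
emb-plugged {i} Γ {Δ} {B} = subst (λ T → ⌊ T ⌋ ⊢[ i ] B) (sym (embT-plug Γ Δ))

emb-unplugged : ∀ {i} Γ {Δ B} → ⌊ embT (Γ [ Δ ]) ⌋ ⊢[ i ] B → ⌊ embC Γ [ embT Δ ]ₘ ⌋ ⊢[ i ] B
emb-unplugged {i} Γ {Δ} {B} = subst (λ T → ⌊ T ⌋ ⊢[ i ] B) (embT-plug Γ Δ)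

emb-⊢ : ∀ {i Γ A} → Γ ⊢ A → embA Γ ⊢[ i ] emb A
emb-⊢ id = id
emb-⊢ dist = dist
emb-⊢ (⊥L Γ) = emb-plugged Γ (⊥L (embC Γ))
emb-⊢ ⊤R = ⊤R
emb-⊢ negL = negL
emb-⊢ negR = negR
emb-⊢ (＼L Γ d e) = emb-plugged Γ (＼L (embC Γ) (emb-⊢ d) (emb-unplugged Γ (emb-⊢ e)))
emb-⊢ (＼R {ε} d) = ＼R (emb-⊢ d)
emb-⊢ (＼R {⌊ _ ⌋} d) = ＼R (emb-⊢ d)
emb-⊢ (／L Γ d e) = emb-plugged Γ (／L (embC Γ) (emb-unplugged Γ (emb-⊢ d)) (emb-⊢ e))
emb-⊢ (／R {ε} d) = ／R (emb-⊢ d)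
emb-⊢ (／R {⌊ _ ⌋} d) = ／R (emb-⊢ d)
emb-⊢ (·L Γ d) = emb-plugged Γ (·L (embC Γ) (emb-unplugged Γ (emb-⊢ d)))
emb-⊢ (·R d e) = ·R (emb-⊢ d) (emb-⊢ e)
emb-⊢ (cut Γ d e) = emb-plugged Γ (cut (embC Γ) (emb-⊢ d) (emb-unplugged Γ (emb-⊢ e)))
emb-⊢ (∧L₁ Γ d) = emb-plugged Γ (∧L₁ (embC Γ) (emb-unplugged Γ (emb-⊢ d)))
emb-⊢ (∧L₂ Γ d) = emb-plugged Γ (∧L₂ (embC Γ) (emb-unplugged Γ (emb-⊢ d)))
emb-⊢ (∧R d e) = ∧R (emb-⊢ d) (emb-⊢ e)
emb-⊢ (∨L Γ d e) =
  emb-plugged Γ (∨L (embC Γ) (emb-unplugged Γ (emb-⊢ d)) (emb-unplugged Γ (emb-⊢ e)))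
emb-⊢ (∨R₁ d) = ∨R₁ (emb-⊢ d)
emb-⊢ (∨R₂ d) = ∨R₂ (emb-⊢ d)

erase : MFm → Fm
erase (var p) = var p
erase ⊤ = ⊤
erase ⊥ = ⊥
erase (¬ A) = ¬ erase A
erase (A ∧ B) = erase A ∧ erase B
erase (A ∨ B) = erase A ∨ erase B
erase (A · B) = erase A · erase B
erase (A ＼ B) = erase A ＼ erase B
erase (A ／ B) = erase A ／ erase B
erase (◇ A) = erase A
erase (□↓ A) = erase A

eraseT : MTree → Tree
eraseT (leaf A) = leaf (erase A)
eraseT (Γ ∘ Δ) = eraseT Γ ∘ eraseT Δ
eraseT ⟨ Γ ⟩ = eraseT Γ

eraseA : MAnte → Ante
eraseA ε = ε
eraseA ⌊ Γ ⌋ = ⌊ eraseT Γ ⌋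

eraseC : MCtx → Ctx
eraseC [] = []
eraseC (Γ ∘ˡ Θ) = eraseC Γ ∘ˡ eraseT Θ
eraseC (Θ ∘ʳ Γ) = eraseT Θ ∘ʳ eraseC Γ
eraseC ⟨ Γ ⟩ = eraseC Γ

eraseT-plug : ∀ Γ Δ → eraseT (Γ [ Δ ]ₘ) ≡ eraseC Γ [ eraseT Δ ]
eraseT-plug [] Δ = refl
eraseT-plug (Γ ∘ˡ Θ) Δ = cong (_∘ eraseT Θ) (eraseT-plug Γ Δ)
eraseT-plug (Θ ∘ʳ Γ) Δ = cong (eraseT Θ ∘_) (eraseT-plug Γ Δ)
eraseT-plug ⟨ Γ ⟩ Δ = eraseT-plug Γ Δ

-- Split on excluded middle for ¬ A and distribute; the case A ∧ ¬ A is absurd.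
¬¬-intro : ∀ {A} → ⌊ leaf A ⌋ ⊢ ¬ ¬ A
¬¬-intro {A} = cut [] excludedMiddle (cut [] dist (∨L [] (cut [] negL (⊥L [])) (∧L₂ [] id)))
  where
  excludedMiddle : ⌊ leaf A ⌋ ⊢ A ∧ (¬ A ∨ ¬ ¬ A)
  excludedMiddle = ∧R id (cut [] ⊤R negR)

erase-plugged : ∀ Γ {Δ B} → ⌊ eraseC Γ [ eraseT Δ ] ⌋ ⊢ B → ⌊ eraseT (Γ [ Δ ]ₘ) ⌋ ⊢ B
erase-plugged Γ {Δ} {B} = subst (λ T → ⌊ T ⌋ ⊢ B) (sym (eraseT-plug Γ Δ))

erase-unplugged : ∀ Γ {Δ B} → ⌊ eraseT (Γ [ Δ ]ₘ) ⌋ ⊢ B → ⌊ eraseC Γ [ eraseT Δ ] ⌋ ⊢ B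
erase-unplugged Γ {Δ} {B} = subst (λ T → ⌊ T ⌋ ⊢ B) (eraseT-plug Γ Δ)

erase-⊢ : ∀ {i Γ A} → Γ ⊢[ i ] A → eraseA Γ ⊢ erase A
erase-⊢ id = id
erase-⊢ dist = dist
erase-⊢ (⊥L Γ) = erase-plugged Γ (⊥L (eraseC Γ))
erase-⊢ ⊤R = ⊤R
erase-⊢ negL = negL
erase-⊢ negR = negR
erase-⊢ (＼L Γ d e) = erase-plugged Γ (＼L (eraseC Γ) (erase-⊢ d) (erase-unplugged Γ (erase-⊢ e)))
erase-⊢ (＼R {Γ = ε} d) = ＼R (erase-⊢ d)
erase-⊢ (＼R {Γ = ⌊ _ ⌋} d) = ＼R (erase-⊢ d)
erase-⊢ (／L Γ d e) = erase-plugged Γ (／L (eraseC Γ) (erase-unplugged Γ (erase-⊢ d)) (erase-⊢ e))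
erase-⊢ (／R {Γ = ε} d) = ／R (erase-⊢ d)
erase-⊢ (／R {Γ = ⌊ _ ⌋} d) = ／R (erase-⊢ d)
erase-⊢ (·L Γ d) = erase-plugged Γ (·L (eraseC Γ) (erase-unplugged Γ (erase-⊢ d)))
erase-⊢ (·R d e) = ·R (erase-⊢ d) (erase-⊢ e)
erase-⊢ (cut Γ d e) = erase-plugged Γ (cut (eraseC Γ) (erase-⊢ d) (erase-unplugged Γ (erase-⊢ e)))
erase-⊢ (∧L₁ Γ d) = erase-plugged Γ (∧L₁ (eraseC Γ) (erase-unplugged Γ (erase-⊢ d)))
erase-⊢ (∧L₂ Γ d) = erase-plugged Γ (∧L₂ (eraseC Γ) (erase-unplugged Γ (erase-⊢ d)))
erase-⊢ (∧R d e) = ∧R (erase-⊢ d) (erase-⊢ e)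
erase-⊢ (∨L Γ d e) =
  erase-plugged Γ (∨L (eraseC Γ) (erase-unplugged Γ (erase-⊢ d)) (erase-unplugged Γ (erase-⊢ e)))
erase-⊢ (∨R₁ d) = ∨R₁ (erase-⊢ d)
erase-⊢ (∨R₂ d) = ∨R₂ (erase-⊢ d)
erase-⊢ (◇L Γ d) = erase-plugged Γ (erase-unplugged Γ (erase-⊢ d))
erase-⊢ (◇R d) = erase-⊢ d
erase-⊢ (□↓L Γ d) = erase-plugged Γ (erase-unplugged Γ (erase-⊢ d))
erase-⊢ (□↓R d) = erase-⊢ d
erase-⊢ (axT _) = id
erase-⊢ (ax4 _) = id
erase-⊢ (ax5 _) = ¬¬-intro

erase-emb : ∀ A → erase (emb A) ≡ A
erase-emb (var p) = refl
erase-emb ⊤ = refl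
erase-emb ⊥ = refl
erase-emb (¬ A) = cong ¬_ (erase-emb A)
erase-emb (A ∧ B) = cong₂ _∧_ (erase-emb A) (erase-emb B)
erase-emb (A ∨ B) = cong₂ _∨_ (erase-emb A) (erase-emb B)
erase-emb (A · B) = cong₂ _·_ (erase-emb A) (erase-emb B)
erase-emb (A ＼ B) = cong₂ _＼_ (erase-emb A) (erase-emb B)
erase-emb (A ／ B) = cong₂ _／_ (erase-emb A) (erase-emb B)

eraseT-embT : ∀ Γ → eraseT (embT Γ) ≡ Γ
eraseT-embT (leaf A) = cong leaf (erase-emb A)
eraseT-embT (Γ ∘ Δ) = cong₂ _∘_ (eraseT-embT Γ) (eraseT-embT Δ)

eraseA-embA : ∀ Γ → eraseA (embA Γ) ≡ Γ
eraseA-embA ε = refl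
eraseA-embA ⌊ Γ ⌋ = cong ⌊_⌋ (eraseT-embT Γ)

lemma13 : (i : Sys) (Γ : Ante) (A : Fm) → (Γ ⊢ A) ⇔ (embA Γ ⊢[ i ] emb A)
lemma13 i Γ A = mk⇔ emb-⊢ (λ d → subst₂ _⊢_ (eraseA-embA Γ) (erase-emb A) (erase-⊢ d))
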